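{- Let $v$ be a vtree over variables $\mathbf{X}=\{X_1,\ldots,X_M\}$ whose nodes carry preorder IDs. Let $u,w$ be nodes of $v$ such that the subtrees rooted at $u$ and at $w$ are isomorphic (as ordered binary trees), and let $\delta=\mathtt{ID}(w)-\mathtt{ID}(u)$, which equals the difference of IDs of any pair of corresponding nodes of the two subtrees. Let $\pi_{u,w}:\{1,\ldots,M\}\to\{1,\ldots,M\}$ be a bijection such that $\pi_{u,w}(j)=i$ whenever $X_i$ is the variable of a leaf $u'$ of the subtree at $u$ and $X_j$ is the variable of the leaf $w'$ of the subtree at $w$ corresponding to $u'$ under the isomorphism. Let $f,g$ be Boolean functions over $\mathbf{X}$ such that $f$ essentially depends on vtree node $u$, $g$ essentially depends on vtree node $w$, and $f,g$ are substitution-equivalent with $\pi_{u,w}$. Then the compressed and trimmed VS-SDDs $(\alpha,k)$ and $(\beta,\ell)$ (with respect to $v$) representing $f$ and $g$ respectively satisfy $\alpha=\beta$ and $\ell=k+\delta$.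
   Context: A vtree over a set of variables is an ordered full binary tree whose leaves are in one-to-one correspondence with the variables; $l(x)$ denotes the variable of leaf $x$. Each vtree node $x$ is assigned an integer ID $\mathtt{ID}(x)$ following a preorder traversal; $\mathtt{ID}^{ -1}(i)$ is the node with ID $i$. A node $y$ is a left (resp. right) descendant of $x$ if $y$ is a (not necessarily proper) descendant of the left (resp. right) child of $x$. For disjoint variable sets $\mathbf{X},\mathbf{Y}$, an $\mathbf{X}$-partition of $f(\mathbf{X},\mathbf{Y})$ is an expression $f=\bigvee_{i=1}^n[p_i(\mathbf{X})\wedge s_i(\mathbf{Y})]$ with $p_i\wedge p_j=\mathit{false}$ for $i\ne j$, $\bigvee_i p_i=\mathit{true}$, and $p_i\ne\mathit{false}$ for all $i$; it is compressed if $s_i\neq s_j$ for $i\ne j$. A VS-SDD is a pair $(\alpha,k)$ of a structure $\alpha$ (a node of a DAG) and an integer offset $k$, with semantics $\langle\alpha,k\rangle$ defined recursively: (constant) $\alpha=\top$ or $\bot$, with $\langle\top,\cdot\rangle=\mathit{true}$, $\langle\bot,\cdot\rangle=\mathit{false}$; (literal) $\alpha=\mathbf{v}$ or $\neg\mathbf{v}$ where $\mathtt{ID}^{ -1}(k)$ is a leaf, with $\langle\mathbf{v},k\rangle=l(\mathtt{ID}^{ -1}(k))$ and $\langle\neg\mathbf{v},k\rangle=\neg l(\mathtt{ID}^{ -1}(k))$; (decomposition) $\alpha=\{([p_1,d_1],[s_1,e_1]),\ldots,([p_n,d_n],[s_n,e_n])\}$ where $\mathtt{ID}^{ -1}(k)$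 is internal, each $p_i,s_i$ is a structure, $d_i,e_i$ are integers with $\mathtt{ID}^{ -1}(d_i+k)$ a left descendant and $\mathtt{ID}^{ -1}(e_i+k)$ a right descendant of $\mathtt{ID}^{ -1}(k)$, and $\langle p_1,d_1+k\rangle,\ldots,\langle p_n,d_n+k\rangle$ form a partition; $\langle\alpha,k\rangle=\bigvee_i(\langle p_i,d_i+k\rangle\wedge\langle s_i,e_i+k\rangle)$. Identical structures are shared only when their offsets correspond to vtree nodes with isomorphic subtrees. A VS-SDD is compressed if every decomposition $(\beta,\ell)$ appearing in it forms a compressed partition; it is trimmed if it contains no decomposition of the form $\{([\top,\cdot],[\beta,d])\}$ or $\{([\beta,d],[\top,\cdot]),([\neg\beta,d],[\bot,\cdot])\}$. A Boolean function $f$ essentially depends on variable $X$ if $f|X\ne f|\neg X$; $f$ essentially depends on vtree node $x$ if $f$ is non-trivial (not constantly true/false) and $x$ is the deepest vtree node whose leaves include all variables $f$ essentially depends on. Two Boolean functions $f,g$ over $X_1,\ldots,X_M$ are substitution-equivalent with a bijection $\pi$ of $\{1,\ldots,M\}$ if $f(X_1=x_1,\ldots,X_M=x_M)=g(X_1=x_{\pi(1)},\ldots,X_M=x_{\pi(M)})$ for every assignment. -}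

module Defs where

open import Data.Nat using (ℕ; zero; suc; _+_; _≤_)
open import Data.Bool using (Bool; true; false; not; _∧_; _∨_; if_then_else_)
open import Data.Fin using (Fin; _≟_)
open import Data.List using (List; []; _∷_; _++_; map; allFin; length; lookup)
open import Data.Bool.ListAction using (or)
open import Data.List.Relation.Unary.All using (All)
open import Data.List.Relation.Unary.Any using (Any)
open import Data.List.Membership.Propositional using (_∈_)
open import Data.List.Relation.Binary.Permutation.Propositional using (_↭_)
open import Data.Product using (_×_; _,_; proj₁; proj₂; ∃; ∃-syntax; Σ-syntax)
open import Data.Sum using (_⊎_)
open import Data.Unit using (⊤)
open import Relation.Nullary using (¬_; Dec; yes; no)
open import Relation.Binary.PropositionalEquality using (_≡_; _≢_)

Assignment : ℕ → Set
Assignment M = Fin M → Bool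

BoolFun : ℕ → Set
BoolFun M = Assignment M → Bool

_[_≔_] : ∀ {M} → Assignment M → Fin M → Bool → Assignment M
(a [ x ≔ b ]) y with y ≟ x
... | yes _ = b
... | no  _ = a y

DependsOn : ∀ {M} → BoolFun M → Fin M → Set
DependsOn f x = ¬ (∀ a → f (a [ x ≔ true ]) ≡ f (a [ x ≔ false ]))

Nontrivial : ∀ {M} → BoolFun M → Set
Nontrivial f = ¬ (∀ a → f a ≡ true) × ¬ (∀ a → f a ≡ false)

data VTree (M : ℕ) : Set where
  leaf : Fin M → VTree M
  node : VTree M → VTree M → VTree M

size : ∀ {M} → VTree M → ℕ
size (leaf _)   = 1
size (node l r) = suc (size l + size r)

leaves : ∀ {M} → VTree M → List (Fin M)
leaves (leaf x)   = x ∷ []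
leaves (node l r) = leaves l ++ leaves r

IsVtree : ∀ {M} → VTree M → Set
IsVtree {M} v = leaves v ↭ allFin M

-- Node t i d s : the node of t with preorder ID i (root has ID 0)
-- has depth d and its subtree is s.
data Node {M : ℕ} : VTree M → ℕ → ℕ → VTree M → Set where
  here  : ∀ {t} → Node t 0 0 t
  left  : ∀ {l r i d s} → Node l i d s → Node (node l r) (suc i) (suc d) s
  right : ∀ {l r i d s} → Node r i d s →
          Node (node l r) (suc (size l + i)) (suc d) s

-- ID⁻¹(j) is a left (resp. right) descendant of the internal node ID⁻¹(k)
LeftDesc : ∀ {M} → VTree M → ℕ → ℕ → Set
LeftDesc v k j = ∃[ l ] ∃[ r ] ∃[ d ] (Node v k d (node l r) ×
  ∃[ j' ] ∃[ d' ] ∃[ s ] (Node l j' d' s × j ≡ k + suc j'))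

RightDesc : ∀ {M} → VTree M → ℕ → ℕ → Set
RightDesc v k j = ∃[ l ] ∃[ r ] ∃[ d ] (Node v k d (node l r) ×
  ∃[ j' ] ∃[ d' ] ∃[ s ] (Node r j' d' s × j ≡ k + suc (size l + j')))

EssDepNode : ∀ {M} → VTree M → BoolFun M → ℕ → Set
EssDepNode v f u = Nontrivial f ×
  ∃[ du ] ∃[ tu ] (Node v u du tu × (∀ x → DependsOn f x → x ∈ leaves tu) ×
    (∀ j dj tj → Node v j dj tj → (∀ x → DependsOn f x → x ∈ leaves tj) → dj ≤ du))

data Iso {M : ℕ} : VTree M → VTree M → Set where
  leaf : ∀ x y → Iso (leaf x) (leaf y)
  node : ∀ {l r l' r'} → Iso l l' → Iso r r' → Iso (node l r) (node l' r')

corr : ∀ {M} {t s : VTree M} → Iso t s → List (Fin M × Fin M)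
corr (leaf x y)   = (x , y) ∷ []
corr (node i₁ i₂) = corr i₁ ++ corr i₂

-- VS-SDD syntax.
-- A reference [α, d] is either a constant (no offset, written [⊤,·]/[⊥,·]
-- in the paper) or a non-constant structure with an offset.

mutual
  data Struct : Set where
    lit : Bool → Struct                -- lit true = v, lit false = ¬v
    dec : List (VS × VS) → Struct

  data VS : Set where
    const : Bool → VS
    ⟨_,_⟩ : Struct → ℕ → VS

IsPartition : ∀ {M} → List (BoolFun M) → Set
IsPartition ps =
  (∀ i j → i ≢ j → ∀ a → (lookup ps i a ∧ lookup ps j a) ≡ false) ×
  (∀ a → or (map (λ p → p a) ps) ≡ true) ×
  (∀ i → ¬ (∀ a → lookup ps i a ≡ false))

module Semantics {M : ℕ} (v : VTree M) where

  LeftOK : ℕ → VS → Set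
  LeftOK k (const _)   = ⊤
  LeftOK k ⟨ _ , d ⟩   = LeftDesc v k (d + k)

  RightOK : ℕ → VS → Set
  RightOK k (const _)  = ⊤
  RightOK k ⟨ _ , e ⟩  = RightDesc v k (e + k)

  -- Sem α k h : ⟨α, k⟩ is well-defined w.r.t. v and denotes h
  mutual
    data Sem : Struct → ℕ → BoolFun M → Set where
      sem-lit : ∀ {b k d x h} → Node v k d (leaf x) →
                (∀ a → h a ≡ (if b then a x else not (a x))) →
                Sem (lit b) k h
      sem-dec : ∀ {els k d l r fs h} → Node v k d (node l r) →
                SemEls k els fs →
                IsPartition (map proj₁ fs) →
                (∀ a → h a ≡ or (map (λ ps → proj₁ ps a ∧ proj₂ ps a) fs)) →
                Sem (dec els) k h

    -- semantics of a reference [α, d] relative to the parent offset k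
    data SemV (k : ℕ) : VS → BoolFun M → Set where
      semv-const : ∀ {b h} → (∀ a → h a ≡ b) → SemV k (const b) h
      semv-str   : ∀ {s d h} → Sem s (d + k) h → SemV k ⟨ s , d ⟩ h

    data SemEls (k : ℕ) : List (VS × VS) → List (BoolFun M × BoolFun M) → Set where
      []  : SemEls k [] []
      _∷_ : ∀ {p s hp hs els fs} →
            (LeftOK k p × RightOK k s × SemV k p hp × SemV k s hs) →
            SemEls k els fs → SemEls k ((p , s) ∷ els) ((hp , hs) ∷ fs)

  mutual
    Compressed : Struct → ℕ → Set
    Compressed (lit _)   k = ⊤
    Compressed (dec els) k = DistinctSubs k els × CompressedEls k els

    DistinctSubs : ℕ → List (VS × VS) → Set
    DistinctSubs k els = ∀ i j → i ≢ j → ∀ h₁ h₂ →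
      SemV k (proj₂ (lookup els i)) h₁ → SemV k (proj₂ (lookup els j)) h₂ →
      ¬ (∀ a → h₁ a ≡ h₂ a)

    CompressedV : ℕ → VS → Set
    CompressedV k (const _) = ⊤
    CompressedV k ⟨ s , d ⟩ = Compressed s (d + k)

    CompressedEls : ℕ → List (VS × VS) → Set
    CompressedEls k []             = ⊤
    CompressedEls k ((p , s) ∷ es) = CompressedV k p × CompressedV k s × CompressedEls k es

open Semantics public

-- trimming: no decomposition {([⊤,·],[β,d])} or {([β,d],[⊤,·]),([¬β,d],[⊥,·])}
Form1 : List (VS × VS) → Set
Form1 els = ∃[ x ] (els ≡ (const true , x) ∷ [])

Form2 : List (VS × VS) → Set
Form2 els = ∃[ p ] ∃[ q ]
  (els ≡ (p , const true) ∷ (q , const false) ∷ [] ⊎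
   els ≡ (q , const false) ∷ (p , const true) ∷ [])

mutual
  Trimmed : Struct → Set
  Trimmed (lit _)   = ⊤
  Trimmed (dec els) = ¬ Form1 els × ¬ Form2 els × TrimmedEls els

  TrimmedV : VS → Set
  TrimmedV (const _) = ⊤
  TrimmedV ⟨ s , _ ⟩ = Trimmed s

  TrimmedEls : List (VS × VS) → Set
  TrimmedEls []             = ⊤
  TrimmedEls ((p , s) ∷ es) = TrimmedV p × TrimmedV s × TrimmedEls es

-- identity of structures: a decomposition is a SET of elements
mutual
  data _≈S_ : Struct → Struct → Set where
    lit≈ : ∀ {b} → lit b ≈S lit b
    dec≈ : ∀ {xs ys} → All (λ e → Any (e ≈E_) ys) xs →
           All (λ e → Any (e ≈E_) xs) ys → dec xs ≈S dec ys

  data _≈V_ : VS → VS → Set where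
    const≈ : ∀ {b} → const b ≈V const b
    str≈   : ∀ {s t d} → s ≈S t → ⟨ s , d ⟩ ≈V ⟨ t , d ⟩

  data _≈E_ : VS × VS → VS × VS → Set where
    el≈ : ∀ {p s p' s'} → p ≈V p' → s ≈V s' → (p , s) ≈E (p' , s')

-- A vtree node t spans h when h depends only on the variables below t, is non-trivial, and is
-- supported by neither child of t.  When the leaves of the vtree are distinct, at most one node
-- spans h, since two candidates on different branches would give h disjoint supports; so the
-- node spanning h is the node h essentially depends on.
--
-- By induction over a compressed trimmed VS-SDD (α, k), its function is spanned by the node with
-- ID k.  Were it supported by the right child of that node, all subs would coincide, so by
-- compression the decomposition would have a single element, which trimming forbids; were it
-- supported by the left child, the subs would be pairwise distinct constants, again a trimmed-away
-- shape.  Hence k = ID(u) and ℓ = ID(w).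
--
-- For α ≈ β we induct on the size of the subtree at k.  Substitution along π carries each prime
-- region of f's partition onto a prime region of g's, the matching being forced by compression;
-- matched primes and subs are substitution-equivalent functions on isomorphic child subtrees,
-- spanned by corresponding nodes, so their offsets agree and their structures coincide by
-- induction.

module Submission where

open import Defs
open import Data.Nat using (ℕ; zero; suc; _≤_; _<_; z≤n; s≤s)
import Data.Nat as ℕ
open import Data.Integer using (+_; _-_; _+_)
open import Data.Integer.Tactic.RingSolver using (solve-∀)
open import Data.Nat.Properties
  using (≤-refl; ≤-trans; ≤-total; ≤-pred; <⇒≱; m≤m+n; m≤n+m; m+n≮m; +-monoʳ-<;
         m≤n⇒m≤n+o; m≤n⇒m≤o+n; m≤n⇒m≤1+n; +-comm; +-assoc; +-cancelˡ-≡; +-cancelʳ-≡; suc-injective)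
open import Data.Bool using (Bool; true; false; not; _∧_; if_then_else_)
open import Data.Bool.ListAction using (or)
import Data.Bool.Properties as Bool
open import Data.Bool.Properties using (∨-identityʳ)
open import Data.Fin using (Fin; zero; suc)
import Data.Fin as Fin
import Data.Fin.Properties as Fin
open import Data.List using (List; []; _∷_; _++_; allFin; map; length; lookup)
open import Data.List.Properties using (tabulate-lookup)
open import Data.List.Membership.Propositional using (_∈_; _∉_; lose)
open import Data.List.Membership.Propositional.Properties
  using (∈-allFin; ∈-++⁺ˡ; ∈-++⁺ʳ; ∈-++⁻; ∈-lookup)
import Data.List.Membership.DecPropositional as DecMembership
open import Data.List.Relation.Binary.Subset.Propositional using (_⊆_)
open import Data.List.Relation.Binary.Disjoint.Propositional using (Disjoint)
open import Data.List.Relation.Unary.All using (All)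
open import Data.List.Relation.Unary.Any using (Any; here; there)
open import Data.List.Relation.Unary.AllPairs using ([]; _∷_)
import Data.List.Relation.Unary.All as All
import Data.List.Relation.Unary.All.Properties as All
open import Data.List.Relation.Unary.Unique.Propositional using (Unique)
open import Data.List.Relation.Unary.Unique.Propositional.Properties using (allFin⁺)
open import Data.List.Relation.Binary.Permutation.Propositional using (↭-sym; ↭⇒↭ₛ)
import Data.List.Relation.Binary.Permutation.Setoid.Properties as PermutationProperties
import Data.Vec.Functional as Vector
open import Data.Product using (_×_; _,_; proj₁; proj₂; ∃-syntax; Σ-syntax)
import Data.Product as Product
open import Data.Sum using (_⊎_; inj₁; inj₂; [_,_]′)
open import Data.Unit using (⊤)
open import Data.Empty using (⊥-elim)
open import Function using (_∘_)
open import Function.Bundles using (_↔_; Inverse; _⤖_; Bijection)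
open import Function.Properties.Bijection using (⤖⇒↔)
open import Function.Properties.Inverse using (↔-sym)
open import Relation.Nullary using (¬_; yes; no)
open import Relation.Nullary.Decidable using (decidable-stable)
open import Relation.Binary.PropositionalEquality
  using (_≡_; _≢_; _≗_; refl; sym; trans; cong; cong₂; subst; subst₂; setoid)

private
  variable
    M : ℕ

true-iff⇒≡ : ∀ {x y} → (x ≡ true → y ≡ true) → (y ≡ true → x ≡ true) → x ≡ y
true-iff⇒≡ {false} {false} _  _  = refl
true-iff⇒≡ {false} {true}  _  y⇒x = y⇒x refl
true-iff⇒≡ {true}  {_}     x⇒y _  = sym (x⇒y refl)

Bool-pigeonhole : ∀ (x y z : Bool) → x ≡ y ⊎ x ≡ z ⊎ y ≡ z
Bool-pigeonhole false false _     = inj₁ refl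
Bool-pigeonhole true  true  _     = inj₁ refl
Bool-pigeonhole false true  false = inj₂ (inj₁ refl)
Bool-pigeonhole true  false true  = inj₂ (inj₁ refl)
Bool-pigeonhole false true  true  = inj₂ (inj₂ refl)
Bool-pigeonhole true  false false = inj₂ (inj₂ refl)

All-lookup⁺ : ∀ {A : Set} {P : A → Set} {xs : List A} → (∀ i → P (lookup xs i)) → All P xs
All-lookup⁺ {P = P} {xs} f = subst (All P) (tabulate-lookup xs) (All.tabulate⁺ f)

-- Supports of Boolean functions

Agree : List (Fin M) → Assignment M → Assignment M → Set
Agree S a b = ∀ {x} → x ∈ S → a x ≡ b x

Supported : BoolFun M → List (Fin M) → Set
Supported h S = ∀ a b → Agree S a b → h a ≡ h b

Extensional : BoolFun M → Set
Extensional h = ∀ {a b} → a ≗ b → h a ≡ h b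

Constant : BoolFun M → Set
Constant h = ∀ a b → h a ≡ h b

module _ {h : BoolFun M} where

  Supported⇒Extensional : ∀ {S} → Supported h S → Extensional h
  Supported⇒Extensional supp a≗b = supp _ _ (λ {x} _ → a≗b x)

  Supported-mono : ∀ {S T} → S ⊆ T → Supported h S → Supported h T
  Supported-mono S⊆T supp a b agree = supp a b (agree ∘ S⊆T)

  ¬Supported⇒Nontrivial : ∀ {S} → ¬ Supported h S → Nontrivial h
  ¬Supported⇒Nontrivial ¬supp =
    (λ all-true → ¬supp λ a b _ → trans (all-true a) (sym (all-true b))) ,
    (λ all-false → ¬supp λ a b _ → trans (all-false a) (sym (all-false b)))

  Constant⇒¬Nontrivial : Constant h → ¬ Nontrivial h
  Constant⇒¬Nontrivial constant (¬true , ¬false) with h (λ _ → false) in eq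
  ... | true  = ¬true  (λ a → trans (constant a _) eq)
  ... | false = ¬false (λ a → trans (constant a _) eq)

module _ {M : ℕ} where
  open DecMembership (Fin._≟_ {M}) using (_∈?_)

  splice : List (Fin M) → Assignment M → Assignment M → Assignment M
  splice S a c x with x ∈? S
  ... | yes _ = a x
  ... | no  _ = c x

  splice-agreeˡ : ∀ S a c → Agree S (splice S a c) a
  splice-agreeˡ S a c {x} x∈S with x ∈? S
  ... | yes _   = refl
  ... | no  x∉S = ⊥-elim (x∉S x∈S)

  splice-agreeʳ : ∀ {S T} a c → Disjoint S T → Agree T (splice S a c) c
  splice-agreeʳ {S} a c S#T {x} x∈T with x ∈? S
  ... | yes x∈S = ⊥-elim (S#T (x∈S , x∈T))
  ... | no  _   = refl

  Supported-disjoint⇒Constant : ∀ {h S T} → Disjoint S T →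
    Supported h S → Supported h T → Constant h
  Supported-disjoint⇒Constant {S = S} S#T suppS suppT a b =
    trans (sym (suppS (splice S a b) a (splice-agreeˡ S a b)))
          (suppT (splice S a b) b (splice-agreeʳ a b S#T))

  update-id : ∀ {a : Assignment M} {x b} → a x ≡ b → (a [ x ≔ b ]) ≗ a
  update-id {x = x} ax≡b y with y Fin.≟ x
  ... | yes refl = sym ax≡b
  ... | no  _    = refl

  update-other : ∀ {a : Assignment M} {x b y} → y ≢ x → (a [ x ≔ b ]) y ≡ a y
  update-other {x = x} {y = y} y≢x with y Fin.≟ x
  ... | yes y≡x = ⊥-elim (y≢x y≡x)
  ... | no  _   = refl

  Supported⇒DependsOn⊆ : ∀ {h S x} → Supported h S → DependsOn h x → x ∈ S
  Supported⇒DependsOn⊆ {S = S} {x} supp dep with x ∈? S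
  ... | yes x∈S = x∈S
  ... | no  x∉S = ⊥-elim (dep λ a → supp _ _ λ y∈S →
        trans (update-other (outside y∈S)) (sym (update-other (outside y∈S))))
    where
    outside : ∀ {y} → y ∈ S → y ≢ x
    outside y∈S refl = x∉S y∈S

  ¬DependsOn⇒update-irrelevant : ∀ {h x} → Extensional h → ¬ DependsOn h x →
    ∀ a b → h (a [ x ≔ b ]) ≡ h a
  ¬DependsOn⇒update-irrelevant {h} {x} ext indep a b =
    decidable-stable (h (a [ x ≔ b ]) Bool.≟ h a)
      λ ≢ → indep λ flip-invariant → ≢ (trans (any-value (a x) b flip-invariant) (ext (update-id refl)))
    where
    any-value : ∀ c d → (∀ a → h (a [ x ≔ true ]) ≡ h (a [ x ≔ false ])) →
      h (a [ x ≔ d ]) ≡ h (a [ x ≔ c ])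
    any-value false false _   = refl
    any-value true  true  _   = refl
    any-value false true  inv = inv a
    any-value true  false inv = sym (inv a)

  DependsOn⊆⇒Supported : ∀ {h S} → Extensional h → (∀ x → DependsOn h x → x ∈ S) →
    Supported h S
  DependsOn⊆⇒Supported {h} {S} ext deps a b agree =
    walk (allFin M) a (λ x∉ → ⊥-elim (x∉ (∈-allFin _))) agree
    where
    step : ∀ a x → Agree S a b → h (a [ x ≔ b x ]) ≡ h a
    step a x agree with x ∈? S
    ... | yes x∈S = ext (update-id (agree x∈S))
    ... | no  x∉S = ¬DependsOn⇒update-irrelevant ext (x∉S ∘ deps x) a (b x)

    walk : ∀ xs a → (∀ {x} → x ∉ xs → a x ≡ b x) → Agree S a b → h a ≡ h b
    walk []       a outside agree = ext (λ x → outside {x} λ ())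
    walk (x ∷ xs) a outside agree =
      trans (sym (step a x agree)) (walk xs (a [ x ≔ b x ]) outside′ agree′)
      where
      agree′ : Agree S (a [ x ≔ b x ]) b
      agree′ {y} y∈S with y Fin.≟ x
      ... | yes refl = refl
      ... | no  _    = agree y∈S
      outside′ : ∀ {y} → y ∉ xs → (a [ x ≔ b x ]) y ≡ b y
      outside′ {y} y∉xs with y Fin.≟ x
      ... | yes refl = refl
      ... | no  y≢x  = outside λ { (here y≡x) → y≢x y≡x ; (there y∈xs) → y∉xs y∈xs }

∷-cong : ∀ {b} {a c : Assignment M} → a ≗ c → (b Vector.∷ a) ≗ (b Vector.∷ c)
∷-cong a≗c zero    = refl
∷-cong a≗c (suc i) = a≗c i

satisfiable? : ∀ M (h : BoolFun M) → Extensional h →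
  (∃[ a ] h a ≡ true) ⊎ (∀ a → h a ≡ false)
satisfiable? zero h ext with h (λ ()) in eq
... | true  = inj₁ (_ , eq)
... | false = inj₂ (λ a → trans (ext (λ ())) eq)
satisfiable? (suc M) h ext
  with satisfiable? M (h ∘ (false Vector.∷_)) (ext ∘ ∷-cong)
     | satisfiable? M (h ∘ (true Vector.∷_)) (ext ∘ ∷-cong)
... | inj₁ (a , ha) | _             = inj₁ (false Vector.∷ a , ha)
... | inj₂ _        | inj₁ (a , ha) = inj₁ (true Vector.∷ a , ha)
... | inj₂ h₀       | inj₂ h₁       =
  inj₂ λ a → trans (ext (head∷tail a)) (by-head (a zero) (Vector.tail a))
  where
  head∷tail : (a : Assignment (suc M)) → a ≗ (a zero Vector.∷ Vector.tail a)
  head∷tail a zero    = refl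
  head∷tail a (suc i) = refl
  by-head : ∀ b a → h (b Vector.∷ a) ≡ false
  by-head false = h₀
  by-head true  = h₁

satisfying-assignment : {h : BoolFun M} → Extensional h →
  ¬ (∀ a → h a ≡ false) → ∃[ a ] h a ≡ true
satisfying-assignment {M} {h} ext unsat with satisfiable? M h ext
... | inj₁ sat   = sat
... | inj₂ unsat′ = ⊥-elim (unsat unsat′)

-- Vtrees

Unique-++⁻ : ∀ {A : Set} (xs : List A) {ys} → Unique (xs ++ ys) →
  Unique xs × Unique ys × Disjoint xs ys
Unique-++⁻ []       u            = [] , u , λ ()
Unique-++⁻ (x ∷ xs) (x∉ ∷ u) with Unique-++⁻ xs u
... | uxs , uys , xs#ys = All.++⁻ˡ xs x∉ ∷ uxs , uys , disjoint
  where
  disjoint : Disjoint (x ∷ xs) _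
  disjoint (here refl  , v∈ys) = All.lookup (All.++⁻ʳ xs x∉) v∈ys refl
  disjoint (there v∈xs , v∈ys) = xs#ys (v∈xs , v∈ys)

DisjointLeaves : VTree M → Set
DisjointLeaves (leaf _)   = ⊤
DisjointLeaves (node l r) = Disjoint (leaves l) (leaves r) × DisjointLeaves l × DisjointLeaves r

Unique⇒DisjointLeaves : (t : VTree M) → Unique (leaves t) → DisjointLeaves t
Unique⇒DisjointLeaves (leaf _)   _ = _
Unique⇒DisjointLeaves (node l r) u with Unique-++⁻ (leaves l) u
... | ul , ur , l#r = l#r , Unique⇒DisjointLeaves l ul , Unique⇒DisjointLeaves r ur

IsVtree⇒DisjointLeaves : (v : VTree M) → IsVtree v → DisjointLeaves v
IsVtree⇒DisjointLeaves {M} v perm =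
  Unique⇒DisjointLeaves v (Unique-resp-↭ (↭⇒↭ₛ (↭-sym perm)) (allFin⁺ M))
  where open PermutationProperties (setoid (Fin M)) using (Unique-resp-↭)

private
  variable
    t s s′ : VTree M
    i j d d′ : ℕ

Node-index<size : Node t i d s → i < size t
Node-index<size {t = leaf _}   here      = s≤s z≤n
Node-index<size {t = node _ _} here      = s≤s z≤n
Node-index<size {t = node l r} (left n)  = s≤s (m≤n⇒m≤n+o (size r) (Node-index<size n))
Node-index<size {t = node l r} (right n) = s≤s (+-monoʳ-< (size l) (Node-index<size n))

Node-functional : Node t i d s → Node t j d′ s′ → i ≡ j → d ≡ d′ × s ≡ s′
Node-functional here      here       _    = refl , refl
Node-functional (left n)  (left n′)  i≡j
  with refl , refl ← Node-functional n n′ (suc-injective i≡j) = refl , refl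
Node-functional (right n) (right n′) i≡j
  with refl , refl ← Node-functional n n′ (+-cancelˡ-≡ _ _ _ (suc-injective i≡j)) = refl , refl
Node-functional {t = node l _} (left n) (right _) i≡j =
  ⊥-elim (m+n≮m (size l) _ (subst (_< size l) (suc-injective i≡j) (Node-index<size n)))
Node-functional {t = node l _} (right _) (left n′) i≡j =
  ⊥-elim (m+n≮m (size l) _ (subst (_< size l) (sym (suc-injective i≡j)) (Node-index<size n′)))

Node-trans : ∀ {q e} → Node t i d s → Node s j e q → Node t (i ℕ.+ j) (d ℕ.+ e) q
Node-trans here      m = m
Node-trans (left n)  m = left (Node-trans n m)
Node-trans {t = node l r} {j = j} {q = q} {e} (right {i = i} {d} n) m =
  subst (λ k → Node (node l r) (suc k) (suc (d ℕ.+ e)) q) (sym (+-assoc (size l) i j))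
    (right (Node-trans n m))

Node-leaves⊆ : Node t i d s → leaves s ⊆ leaves t
Node-leaves⊆ here                  = λ x∈ → x∈
Node-leaves⊆ (left n)              = ∈-++⁺ˡ ∘ Node-leaves⊆ n
Node-leaves⊆ {t = node l _} (right n) = ∈-++⁺ʳ (leaves l) ∘ Node-leaves⊆ n

Node-size≤ : Node t i d s → size s ≤ size t
Node-size≤ here                  = ≤-refl
Node-size≤ {t = node l r} (left n)  = m≤n⇒m≤1+n (m≤n⇒m≤n+o (size r) (Node-size≤ n))
Node-size≤ {t = node l r} (right n) = m≤n⇒m≤1+n (m≤n⇒m≤o+n (size l) (Node-size≤ n))

Node-DisjointLeaves : Node t i d s → DisjointLeaves t → DisjointLeaves s
Node-DisjointLeaves here      dl              = dl
Node-DisjointLeaves (left n)  (_ , dl , _)    = Node-DisjointLeaves n dl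
Node-DisjointLeaves (right n) (_ , _ , dr)    = Node-DisjointLeaves n dr

-- Spanning nodes

Split : BoolFun M → VTree M → Set
Split h (leaf _)   = ⊤
Split h (node l r) = ¬ Supported h (leaves l) × ¬ Supported h (leaves r)

record Spans (t : VTree M) (h : BoolFun M) : Set where
  constructor spans
  field
    supported  : Supported h (leaves t)
    nontrivial : Nontrivial h
    split      : Split h t

-- Two supporting nodes off each other's paths would give h disjoint supports.
split-node-deepest : ∀ {v : VTree M} {h} → DisjointLeaves v → Nontrivial h →
  Node v i d s → Split h s → Supported h (leaves s) →
  Node v j d′ s′ → Supported h (leaves s′) → d ≤ d′ → i ≡ j
split-node-deepest _ _ here _ _ here _ _ = refl
split-node-deepest _ _ here (¬suppˡ , _) _ (left m) supp′ _ =
  ⊥-elim (¬suppˡ (Supported-mono (Node-leaves⊆ m) supp′))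
split-node-deepest _ _ here (_ , ¬suppʳ) _ (right m) supp′ _ =
  ⊥-elim (¬suppʳ (Supported-mono (Node-leaves⊆ m) supp′))
split-node-deepest _ _ (left _)  _ _ here _ ()
split-node-deepest _ _ (right _) _ _ here _ ()
split-node-deepest (_ , dl , _) nt (left n) sp supp (left m) supp′ (s≤s d≤d′) =
  cong suc (split-node-deepest dl nt n sp supp m supp′ d≤d′)
split-node-deepest (_ , _ , dr) nt (right n) sp supp (right m) supp′ (s≤s d≤d′) =
  cong (λ k → suc (_ ℕ.+ k)) (split-node-deepest dr nt n sp supp m supp′ d≤d′)
split-node-deepest (l#r , _) nt (left n) _ supp (right m) supp′ _ =
  ⊥-elim (Constant⇒¬Nontrivial (Supported-disjoint⇒Constant l#r
    (Supported-mono (Node-leaves⊆ n) supp) (Supported-mono (Node-leaves⊆ m) supp′)) nt)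
split-node-deepest (l#r , _) nt (right n) _ supp (left m) supp′ _ =
  ⊥-elim (Constant⇒¬Nontrivial (Supported-disjoint⇒Constant l#r
    (Supported-mono (Node-leaves⊆ m) supp′) (Supported-mono (Node-leaves⊆ n) supp)) nt)

Spans-unique : ∀ {v : VTree M} {h} → DisjointLeaves v →
  Node v i d s → Node v j d′ s′ → Spans s h → Spans s′ h → i ≡ j
Spans-unique {d = d} {d′ = d′} dl n n′ (spans supp nt sp) (spans supp′ _ sp′) with ≤-total d d′
... | inj₁ d≤d′ = split-node-deepest dl nt n sp supp n′ supp′ d≤d′
... | inj₂ d′≤d = sym (split-node-deepest dl nt n′ sp′ supp′ n supp d′≤d)

-- Isomorphic subtrees and substitution

Iso-sym : ∀ {t t′ : VTree M} → Iso t t′ → Iso t′ t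
Iso-sym (leaf x y) = leaf y x
Iso-sym (node I J) = node (Iso-sym I) (Iso-sym J)

Iso-size : ∀ {t t′ : VTree M} → Iso t t′ → size t ≡ size t′
Iso-size (leaf _ _) = refl
Iso-size (node I J) = cong₂ (λ m n → suc (m ℕ.+ n)) (Iso-size I) (Iso-size J)

private
  variable
    x y : Fin M

corr-sym : ∀ {t t′ : VTree M} (I : Iso t t′) → (x , y) ∈ corr (Iso-sym I) → (y , x) ∈ corr I
corr-sym (leaf _ _) (here refl) = here refl
corr-sym (node I J) p with ∈-++⁻ (corr (Iso-sym I)) p
... | inj₁ q = ∈-++⁺ˡ (corr-sym I q)
... | inj₂ q = ∈-++⁺ʳ (corr I) (corr-sym J q)

corr⇒∈leavesˡ : ∀ {t t′ : VTree M} (I : Iso t t′) → (x , y) ∈ corr I → x ∈ leaves t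
corr⇒∈leavesˡ (leaf _ _) (here refl) = here refl
corr⇒∈leavesˡ (node {l = l} I J) p with ∈-++⁻ (corr I) p
... | inj₁ q = ∈-++⁺ˡ (corr⇒∈leavesˡ I q)
... | inj₂ q = ∈-++⁺ʳ (leaves l) (corr⇒∈leavesˡ J q)

corr⇒∈leavesʳ : ∀ {t t′ : VTree M} (I : Iso t t′) → (x , y) ∈ corr I → y ∈ leaves t′
corr⇒∈leavesʳ (leaf _ _) (here refl) = here refl
corr⇒∈leavesʳ (node {l' = l′} I J) p with ∈-++⁻ (corr I) p
... | inj₁ q = ∈-++⁺ˡ (corr⇒∈leavesʳ I q)
... | inj₂ q = ∈-++⁺ʳ (leaves l′) (corr⇒∈leavesʳ J q)

∈leavesˡ⇒corr : ∀ {t t′ : VTree M} (I : Iso t t′) → x ∈ leaves t → ∃[ y ] (x , y) ∈ corr I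
∈leavesˡ⇒corr (leaf _ y) (here refl) = y , here refl
∈leavesˡ⇒corr (node {l = l} I J) p with ∈-++⁻ (leaves l) p
... | inj₁ q = Product.map₂ ∈-++⁺ˡ (∈leavesˡ⇒corr I q)
... | inj₂ q = Product.map₂ (∈-++⁺ʳ (corr I)) (∈leavesˡ⇒corr J q)

∈leavesʳ⇒corr : ∀ {t t′ : VTree M} (I : Iso t t′) → y ∈ leaves t′ → ∃[ x ] (x , y) ∈ corr I
∈leavesʳ⇒corr (leaf x _) (here refl) = x , here refl
∈leavesʳ⇒corr (node {l' = l′} I J) p with ∈-++⁻ (leaves l′) p
... | inj₁ q = Product.map₂ ∈-++⁺ˡ (∈leavesʳ⇒corr I q)
... | inj₂ q = Product.map₂ (∈-++⁺ʳ (corr I)) (∈leavesʳ⇒corr J q)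

Iso-Node : ∀ {t t′ : VTree M} (I : Iso t t′) → Node t′ i d s′ →
  ∃[ s ] Node t i d s × Σ[ J ∈ Iso s s′ ] corr J ⊆ corr I
Iso-Node I here = _ , here , I , λ p → p
Iso-Node (node I _) (left n) with s , m , J , J⊆I ← Iso-Node I n =
  s , left m , J , ∈-++⁺ˡ ∘ J⊆I
Iso-Node (node {l = l} I J) (right {i = i} n) with s , m , K , K⊆J ← Iso-Node J n =
  s , subst (λ k → Node _ (suc (k ℕ.+ i)) _ s) (Iso-size I) (right m) , K , ∈-++⁺ʳ (corr I) ∘ K⊆J

_≈[_]_ : BoolFun M → (Fin M → Fin M) → BoolFun M → Set
f ≈[ ρ ] g = ∀ a → f a ≡ g (a ∘ ρ)

Matches : (Fin M → Fin M) → {t t′ : VTree M} → Iso t t′ → Set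
Matches ρ I = ∀ x y → (x , y) ∈ corr I → ρ y ≡ x

module _ {ρ : Fin M → Fin M} {t t′ : VTree M} (I : Iso t t′) (matches : Matches ρ I) where

  Matches-⊆ : ∀ {s s′} (J : Iso s s′) → corr J ⊆ corr I → Matches ρ J
  Matches-⊆ _ J⊆I x y p = matches x y (J⊆I p)

  Matches-leaves : ∀ {y} → y ∈ leaves t′ → ρ y ∈ leaves t
  Matches-leaves {y} y∈ with x , p ← ∈leavesʳ⇒corr I y∈ =
    subst (_∈ leaves t) (sym (matches x y p)) (corr⇒∈leavesˡ I p)

  Supported-transport : ∀ {f g} → f ≈[ ρ ] g → Supported g (leaves t′) → Supported f (leaves t)
  Supported-transport f≈g supp a b agree =
    trans (f≈g a) (trans (supp _ _ (agree ∘ Matches-leaves)) (sym (f≈g b)))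

Matches-left : ∀ {ρ : Fin M → Fin M} {l r l′ r′ : VTree M} (I : Iso l l′) (J : Iso r r′) →
  Matches ρ (node I J) → Matches ρ I
Matches-left _ _ matches x y p = matches x y (∈-++⁺ˡ p)

Matches-right : ∀ {ρ : Fin M → Fin M} {l r l′ r′ : VTree M} (I : Iso l l′) (J : Iso r r′) →
  Matches ρ (node I J) → Matches ρ J
Matches-right I _ matches x y p = matches x y (∈-++⁺ʳ (corr I) p)

module _ (π : Fin M ↔ Fin M) where
  open Inverse π

  Matches-sym : ∀ {t t′ : VTree M} (I : Iso t t′) → Matches to I → Matches from (Iso-sym I)
  Matches-sym I matches x y p = trans (cong from (sym (matches y x (corr-sym I p)))) (strictlyInverseʳ x)

  ≈[]-sym : ∀ {f g} → Extensional g → f ≈[ to ] g → g ≈[ from ] f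
  ≈[]-sym ext f≈g c = trans (ext (λ y → cong c (sym (strictlyInverseʳ y)))) (sym (f≈g (c ∘ from)))

  precompose-injective : ∀ {G G′ : BoolFun M} → Extensional G → Extensional G′ →
    (∀ c → G (c ∘ to) ≡ G′ (c ∘ to)) → G ≗ G′
  precompose-injective ext ext′ eq b =
    trans (ext (λ y → cong b (sym (strictlyInverseʳ y))))
          (trans (eq (b ∘ from)) (ext′ (λ y → cong b (strictlyInverseʳ y))))

  Spans-transport : ∀ {t t′ : VTree M} {f g} (I : Iso t t′) → Matches to I →
    f ≈[ to ] g → Spans t′ g → Spans t f
  Spans-transport {f = f} {g} I matches f≈g (spans supp (¬true , ¬false) sp) =
    spans (Supported-transport I matches f≈g supp)
          ((λ true! → ¬true (λ c → trans (g≈f c) (true! _))) ,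
           (λ false! → ¬false (λ c → trans (g≈f c) (false! _))))
          (split I matches sp)
    where
    g≈f : g ≈[ from ] f
    g≈f = ≈[]-sym (Supported⇒Extensional supp) f≈g

    ¬Supported-transport : ∀ {s s′} (J : Iso s s′) → Matches to J →
      ¬ Supported g (leaves s′) → ¬ Supported f (leaves s)
    ¬Supported-transport J matchesJ ¬supp =
      ¬supp ∘ Supported-transport (Iso-sym J) (Matches-sym J matchesJ) g≈f

    split : ∀ {s s′} (J : Iso s s′) → Matches to J → Split g s′ → Split f s
    split (leaf _ _)   _        _              = _
    split (node J₁ J₂) matchesJ (¬suppˡ , ¬suppʳ) =
      ¬Supported-transport J₁ (Matches-left J₁ J₂ matchesJ) ¬suppˡ ,
      ¬Supported-transport J₂ (Matches-right J₁ J₂ matchesJ) ¬suppʳ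

-- Compressed partitions

record CompressedPartition (L R : List (Fin M)) (n : ℕ) (h : BoolFun M) : Set where
  field
    prime sub         : Fin n → BoolFun M
    disjoint          : Disjoint L R
    prime-supported   : ∀ i → Supported (prime i) L
    sub-supported     : ∀ i → Supported (sub i) R
    prime-exclusive   : ∀ {i j a} → prime i a ≡ true → prime j a ≡ true → i ≡ j
    prime-cover       : ∀ a → ∃[ i ] prime i a ≡ true
    prime-satisfiable : ∀ i → ∃[ a ] prime i a ≡ true
    value             : ∀ {i a} → prime i a ≡ true → h a ≡ sub i a
    sub-injective     : ∀ {i j} → sub i ≗ sub j → i ≡ j

  supported : Supported h (L ++ R)
  supported a b agree with i , pa ← prime-cover a =
    trans (value pa) (trans (sub-supported i a b (agree ∘ ∈-++⁺ʳ L))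
                            (sym (value {i} (trans (sym (prime-supported i a b (agree ∘ ∈-++⁺ˡ))) pa))))

  splice-value : ∀ i c → h (splice L (proj₁ (prime-satisfiable i)) c) ≡ sub i c
  splice-value i c = trans (value prime-holds) (sym (sub-supported i c _ (sym ∘ splice-agreeʳ a c disjoint)))
    where
    a = proj₁ (prime-satisfiable i)
    prime-holds : prime i (splice L a c) ≡ true
    prime-holds = trans (prime-supported i _ a (splice-agreeˡ L a c)) (proj₂ (prime-satisfiable i))

  Supported-right⇒single-element : Supported h R → ∀ i j → i ≡ j
  Supported-right⇒single-element supp i j = sub-injective λ c →
    trans (sym (splice-value i c))
      (trans (supp _ _ λ x∈R → trans (splice-agreeʳ _ c disjoint x∈R)
                                     (sym (splice-agreeʳ _ c disjoint x∈R)))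
             (splice-value j c))

  Supported-left⇒constant-subs : Supported h L → ∀ i → Constant (sub i)
  Supported-left⇒constant-subs supp i c c′ =
    trans (sym (splice-value i c))
      (trans (supp _ _ λ x∈L → trans (splice-agreeˡ L _ c x∈L) (sym (splice-agreeˡ L _ c′ x∈L)))
             (splice-value i c′))

module _ (π : Fin M ↔ Fin M) {L R L′ R′ : List (Fin M)} {n n′ f g}
         (A : CompressedPartition L R n f) (B : CompressedPartition L′ R′ n′ g)
         (L′↦L : ∀ {y} → y ∈ L′ → Inverse.to π y ∈ L)
         (R′↦R : ∀ {y} → y ∈ R′ → Inverse.to π y ∈ R)
         (f≈g : f ≈[ Inverse.to π ] g) where
  open Inverse π using (to)
  private
    module A = CompressedPartition A
    module B = CompressedPartition B

  -- Both sides are evaluated at the splice of c₀ on L with c on R, where prime i holds and,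
  -- after substitution, so does prime i′.
  related-subs : ∀ {i i′} c₀ → A.prime i c₀ ≡ true → B.prime i′ (c₀ ∘ to) ≡ true →
    A.sub i ≈[ to ] B.sub i′
  related-subs {i} {i′} c₀ primeA primeB c =
    trans (A.sub-supported i c m (sym ∘ splice-agreeʳ c₀ c A.disjoint))
      (trans (sym (A.value primeA-m))
        (trans (f≈g m)
          (trans (B.value primeB-m) (B.sub-supported i′ _ _ (splice-agreeʳ c₀ c A.disjoint ∘ R′↦R)))))
    where
    m = splice L c₀ c
    primeA-m : A.prime i m ≡ true
    primeA-m = trans (A.prime-supported i m c₀ (splice-agreeˡ L c₀ c)) primeA
    primeB-m : B.prime i′ (m ∘ to) ≡ true
    primeB-m = trans (B.prime-supported i′ _ _ (splice-agreeˡ L c₀ c ∘ L′↦L)) primeB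

  -- i′ is the element of B whose prime holds at the image of a point of prime i; compression
  -- makes the choice independent of that point.
  matching-element : ∀ i → ∃[ i′ ] A.prime i ≈[ to ] B.prime i′ × A.sub i ≈[ to ] B.sub i′
  matching-element i = i′ , primes , subs
    where
    c₀ = proj₁ (A.prime-satisfiable i)
    i′ = proj₁ (B.prime-cover (c₀ ∘ to))
    subs : A.sub i ≈[ to ] B.sub i′
    subs = related-subs c₀ (proj₂ (A.prime-satisfiable i)) (proj₂ (B.prime-cover (c₀ ∘ to)))

    primes : A.prime i ≈[ to ] B.prime i′
    primes a = true-iff⇒≡ A⇒B B⇒A
      where
      A⇒B : A.prime i a ≡ true → B.prime i′ (a ∘ to) ≡ true
      A⇒B primeA with j′ , primeB ← B.prime-cover (a ∘ to) =
        subst (λ k → B.prime k (a ∘ to) ≡ true)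
          (B.sub-injective (precompose-injective π (ext j′) (ext i′)
            λ c → trans (sym (related-subs a primeA primeB c)) (subs c)))
          primeB
        where
        ext : ∀ k → Extensional (B.sub k)
        ext k = Supported⇒Extensional (B.sub-supported k)
      B⇒A : B.prime i′ (a ∘ to) ≡ true → A.prime i a ≡ true
      B⇒A primeB with j , primeA ← A.prime-cover a =
        subst (λ k → A.prime k a ≡ true)
          (A.sub-injective λ c → trans (related-subs a primeA primeB c) (sym (subs c)))
          primeA

-- Decompositions of VS-SDDs

data Side : Set where
  L R : Side

child : Side → VTree M → VTree M → VTree M
child L l _ = l
child R _ r = r

offset : Side → VTree M → ℕ → ℕ
offset L _ j = suc j
offset R l j = suc (size l ℕ.+ j)

offset-cong : ∀ S {l l′ : VTree M} j → size l ≡ size l′ → offset S l j ≡ offset S l′ j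
offset-cong L _ _  = refl
offset-cong R j eq = cong (λ n → suc (n ℕ.+ j)) eq

module _ {l r : VTree M} where

  Node-child : ∀ S {s j d} → Node (child S l r) j d s → Node (node l r) (offset S l j) (suc d) s
  Node-child L n = left n
  Node-child R n = right n

  child-size< : ∀ S → size (child S l r) < size (node l r)
  child-size< L = s≤s (m≤m+n (size l) (size r))
  child-size< R = s≤s (m≤n+m (size r) (size l))

  child-DisjointLeaves : ∀ S → DisjointLeaves (node l r) → DisjointLeaves (child S l r)
  child-DisjointLeaves L (_ , dl , _) = dl
  child-DisjointLeaves R (_ , _ , dr) = dr

⋁ : List (BoolFun M × BoolFun M) → BoolFun M
⋁ fs a = or (map (λ ps → proj₁ ps a ∧ proj₂ ps a) fs)

module Elements {M : ℕ} (v : VTree M) {k : ℕ} where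

  prime sub : ∀ {els fs} → SemEls v k els fs → Fin (length els) → BoolFun M
  prime (_∷_ {hp = hp} _ _) zero    = hp
  prime (_ ∷ se)            (suc i) = prime se i
  sub   (_∷_ {hs = hs} _ _) zero    = hs
  sub   (_ ∷ se)            (suc i) = sub se i

  sub-sem : ∀ {els fs} (se : SemEls v k els fs) i → SemV v k (proj₂ (lookup els i)) (sub se i)
  sub-sem ((_ , _ , _ , sem) ∷ _) zero    = sem
  sub-sem (_ ∷ se)                (suc i) = sub-sem se i

  private
    index : ∀ {els fs} → SemEls v k els fs → Fin (length els) → Fin (length (map proj₁ fs))
    index (_ ∷ _)  zero    = zero
    index (_ ∷ se) (suc i) = suc (index se i)

    lookup-index : ∀ {els fs} (se : SemEls v k els fs) i → lookup (map proj₁ fs) (index se i) ≡ prime se i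
    lookup-index (_ ∷ _)  zero    = refl
    lookup-index (_ ∷ se) (suc i) = lookup-index se i

    index-injective : ∀ {els fs} (se : SemEls v k els fs) {i j} → index se i ≡ index se j → i ≡ j
    index-injective (_ ∷ _)  {zero}  {zero}  _  = refl
    index-injective (_ ∷ se) {suc i} {suc j} eq = cong suc (index-injective se (Fin.suc-injective eq))

  module _ {els fs} (se : SemEls v k els fs) (part : IsPartition (map proj₁ fs)) where

    private
      primes-disjoint : ∀ {i j} → i ≢ j → ∀ a → (prime se i a ∧ prime se j a) ≡ false
      primes-disjoint {i} {j} i≢j a = subst₂ (λ p q → (p a ∧ q a) ≡ false)
        (lookup-index se i) (lookup-index se j) (proj₁ part _ _ (i≢j ∘ index-injective se) a)

    prime-exclusive : ∀ {i j a} → prime se i a ≡ true → prime se j a ≡ true → i ≡ j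
    prime-exclusive {i} {j} {a} pi pj with i Fin.≟ j
    ... | yes i≡j = i≡j
    ... | no  i≢j with () ← trans (sym (cong₂ _∧_ pi pj)) (primes-disjoint i≢j a)

    prime-cover : ∀ a → ∃[ i ] prime se i a ≡ true
    prime-cover a = cover se (proj₁ (proj₂ part) a)
      where
      cover : ∀ {els fs} (se : SemEls v k els fs) → or (map (λ p → p a) (map proj₁ fs)) ≡ true →
        ∃[ i ] prime se i a ≡ true
      cover (_∷_ {hp = hp} _ se) any with hp a in eq
      ... | true  = zero , eq
      ... | false with i , pi ← cover se any = suc i , pi

    prime-nonempty : ∀ i → ¬ (∀ a → prime se i a ≡ false)
    prime-nonempty i empty = proj₂ (proj₂ part) (index se i) λ a →
      trans (cong (λ p → p a) (lookup-index se i)) (empty a)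

  ⋁-no-prime : ∀ {els fs} (se : SemEls v k els fs) {a} → (∀ j → prime se j a ≡ false) →
    ⋁ fs a ≡ false
  ⋁-no-prime []       _        = refl
  ⋁-no-prime (_ ∷ se) none rewrite none zero = ⋁-no-prime se (none ∘ suc)

  ⋁-at-prime : ∀ {els fs} (se : SemEls v k els fs) {i a} → prime se i a ≡ true →
    (∀ j → j ≢ i → prime se j a ≡ false) → ⋁ fs a ≡ sub se i a
  ⋁-at-prime (_∷_ {hs = hs} _ se) {zero} {a} pi others
    rewrite pi | ⋁-no-prime se (λ j → others (suc j) λ ()) = ∨-identityʳ (hs a)
  ⋁-at-prime (_ ∷ se) {suc i} pi others rewrite others zero (λ ()) =
    ⋁-at-prime se pi λ j j≢i → others (suc j) (j≢i ∘ Fin.suc-injective)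

literal-Spans : ∀ {b x} {h : BoolFun M} → (∀ a → h a ≡ (if b then a x else not (a x))) →
  Spans (leaf x) h
literal-Spans {b = b} {x} {h} denotes =
  spans (λ a c agree → trans (denotes a) (trans (cong (λ y → if b then y else not y) (agree (here refl)))
                                            (sym (denotes c))))
        ((λ all-true → true≢false (trans (sym (all-true _)) (trans (denotes _) (at-not b)))) ,
         (λ all-false → true≢false (trans (sym (trans (denotes _) (at-self b))) (all-false _))))
        _
  where
  true≢false : true ≢ false
  true≢false ()
  at-self : ∀ b → (if b then b else not b) ≡ true
  at-self true  = refl
  at-self false = refl
  at-not : ∀ b → (if b then not b else not (not b)) ≡ false
  at-not true  = refl
  at-not false = refl

literal-sign : ∀ {b x} {h : BoolFun M} → (∀ a → h a ≡ (if b then a x else not (a x))) →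
  h (λ _ → true) ≡ b
literal-sign {b = true}  denotes = denotes _
literal-sign {b = false} denotes = denotes _

module _ {M : ℕ} (v : VTree M) (disjoint-leaves : DisjointLeaves v) where
  open Elements v

  Below : Side → ℕ → VS → Set
  Below L = LeftOK v
  Below R = RightOK v

  Below-child : ∀ S {k dk l r α e} → Node v k dk (node l r) → Below S k ⟨ α , e ⟩ →
    ∃[ j ] ∃[ dj ] ∃[ sp ] Node (child S l r) j dj sp × e ℕ.+ k ≡ k ℕ.+ offset S l j
  Below-child L nd (_ , _ , _ , nd′ , j , dj , sp , n , eq)
    with refl , refl ← Node-functional nd nd′ refl = j , dj , sp , n , eq
  Below-child R nd (_ , _ , _ , nd′ , j , dj , sp , n , eq)
    with refl , refl ← Node-functional nd nd′ refl = j , dj , sp , n , eq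

  record Canonical (α : Struct) (k : ℕ) (h : BoolFun M) : Set where
    constructor canonical
    field
      sem        : Sem v α k h
      compressed : Compressed v α k
      trimmed    : Trimmed α

  -- A reference on side S of a decomposition at the node (node l r) with ID k: a constant, or a
  -- canonical VS-SDD at a node of that child which spans its function.
  data Ref (S : Side) (k : ℕ) (l r : VTree M) (h : BoolFun M) : VS → Set where
    const-ref : ∀ {b} → (∀ a → h a ≡ b) → Ref S k l r h (const b)
    str-ref   : ∀ {α j dj sp dd} → Node (child S l r) j dj sp → Node v (offset S l j ℕ.+ k) dd sp →
                Canonical α (offset S l j ℕ.+ k) h → Spans sp h → Ref S k l r h ⟨ α , offset S l j ⟩

  module _ {S : Side} {k : ℕ} {l r : VTree M} {h : BoolFun M} where

    Ref-supported : ∀ {p} → Ref S k l r h p → Supported h (leaves (child S l r))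
    Ref-supported (const-ref q)          a c _ = trans (q a) (sym (q c))
    Ref-supported (str-ref n _ _ spanned) = Supported-mono (Node-leaves⊆ n) (Spans.supported spanned)

    Ref-constant : ∀ {p} → Constant h → Ref S k l r h p → ∃[ b ] p ≡ const b × (∀ a → h a ≡ b)
    Ref-constant _        (const-ref q)          = _ , refl , q
    Ref-constant constant (str-ref _ _ _ spanned) =
      ⊥-elim (Constant⇒¬Nontrivial constant (Spans.nontrivial spanned))

  compressed-partition : ∀ {k dk l r els fs h} → Node v k dk (node l r) → (se : SemEls v k els fs) →
    IsPartition (map proj₁ fs) → (∀ a → h a ≡ ⋁ fs a) → DistinctSubs v k els →
    (∀ i → Ref L k l r (prime se i) (proj₁ (lookup els i))) →
    (∀ i → Ref R k l r (sub se i) (proj₂ (lookup els i))) →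
    CompressedPartition (leaves l) (leaves r) (length els) h
  compressed-partition nd se part ev distinct primeRef subRef = record
    { prime             = prime se
    ; sub               = sub se
    ; disjoint          = proj₁ (Node-DisjointLeaves nd disjoint-leaves)
    ; prime-supported   = Ref-supported ∘ primeRef
    ; sub-supported     = Ref-supported ∘ subRef
    ; prime-exclusive   = prime-exclusive se part
    ; prime-cover       = prime-cover se part
    ; prime-satisfiable = λ i →
        satisfying-assignment (Supported⇒Extensional (Ref-supported (primeRef i))) (prime-nonempty se part i)
    ; value             = λ pi → trans (ev _) (⋁-at-prime se pi λ j j≢i →
        Bool.¬-not (j≢i ∘ λ pj → prime-exclusive se part pj pi))
    ; sub-injective     = λ {i} {j} sub≗ → decidable-stable (i Fin.≟ j) λ i≢j →
        distinct i j i≢j _ _ (sub-sem se i) (sub-sem se j) sub≗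
    }

  module _ {k : ℕ} {l r : VTree M} where

    prime-everywhere : ∀ {e fs} (se : SemEls v k (e ∷ []) fs) → IsPartition (map proj₁ fs) →
      ∀ a → prime se zero a ≡ true
    prime-everywhere se part a with zero , pa ← prime-cover se part a = pa

    single-element⇒Form1 : ∀ {p s fs} (se : SemEls v k ((p , s) ∷ []) fs) →
      IsPartition (map proj₁ fs) → Ref L k l r (prime se zero) p → Form1 ((p , s) ∷ [])
    single-element⇒Form1 se part primeRef
      with Ref-constant (λ a b → trans (prime-everywhere se part a) (sym (prime-everywhere se part b)))
                        primeRef
    ... | true  , refl , _      = _ , refl
    ... | false , refl , false! with () ← trans (sym (false! _)) (prime-everywhere se part (λ _ → false))

    ¬Form1⇒two-elements : ∀ {els fs} (se : SemEls v k els fs) → IsPartition (map proj₁ fs) →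
      (∀ i → Ref L k l r (prime se i) (proj₁ (lookup els i))) → ¬ Form1 els →
      Σ[ i ∈ Fin (length els) ] Σ[ j ∈ Fin (length els) ] i ≢ j
    ¬Form1⇒two-elements [] part _ _ with () ← proj₁ (prime-cover {k = k} [] part (λ _ → false))
    ¬Form1⇒two-elements se@(_ ∷ []) part primeRef ¬form₁ =
      ⊥-elim (¬form₁ (single-element⇒Form1 se part (primeRef zero)))
    ¬Form1⇒two-elements (_ ∷ _ ∷ _) _ _ _ = zero , suc zero , λ ()

    distinct-constant-subs⇒Form1⊎Form2 : ∀ {els fs} (se : SemEls v k els fs) →
      IsPartition (map proj₁ fs) → (∀ i → Ref L k l r (prime se i) (proj₁ (lookup els i))) →
      (b : ∀ i → ∃[ c ] proj₂ (lookup els i) ≡ const c) →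
      (∀ {i j} → i ≢ j → proj₁ (b i) ≢ proj₁ (b j)) → Form1 els ⊎ Form2 els
    distinct-constant-subs⇒Form1⊎Form2 [] part _ _ _
      with () ← proj₁ (prime-cover {k = k} [] part (λ _ → false))
    distinct-constant-subs⇒Form1⊎Form2 se@(_ ∷ []) part primeRef _ _ =
      inj₁ (single-element⇒Form1 se part (primeRef zero))
    distinct-constant-subs⇒Form1⊎Form2 (_ ∷ _ ∷ []) _ _ b distinct
      with b zero | b (suc zero) | distinct {zero} {suc zero} (λ ())
    ... | true  , refl | true  , refl | ≢ = ⊥-elim (≢ refl)
    ... | false , refl | false , refl | ≢ = ⊥-elim (≢ refl)
    ... | true  , refl | false , refl | _ = inj₂ (_ , _ , inj₁ refl)
    ... | false , refl | true  , refl | _ = inj₂ (_ , _ , inj₂ refl)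
    distinct-constant-subs⇒Form1⊎Form2 (_ ∷ _ ∷ _ ∷ _) _ _ b distinct =
      ⊥-elim ([ distinct {zero} {suc zero} (λ ()) , [ distinct {zero} {suc (suc zero)} (λ ()) ,
                                                     distinct {suc zero} {suc (suc zero)} (λ ()) ]′ ]′
               (Bool-pigeonhole (proj₁ (b zero)) (proj₁ (b (suc zero))) (proj₁ (b (suc (suc zero))))))

  decomposition-Spans : ∀ {k dk l r els fs h} (nd : Node v k dk (node l r)) (se : SemEls v k els fs) →
    (part : IsPartition (map proj₁ fs)) → (∀ a → h a ≡ ⋁ fs a) → DistinctSubs v k els →
    ¬ Form1 els → ¬ Form2 els →
    (∀ i → Ref L k l r (prime se i) (proj₁ (lookup els i))) →
    (∀ i → Ref R k l r (sub se i) (proj₂ (lookup els i))) → Spans (node l r) h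
  decomposition-Spans {l = l} {r} {els} {h = h} nd se part ev distinct ¬form₁ ¬form₂ primeRef subRef =
    spans P.supported (¬Supported⇒Nontrivial ¬supportedʳ) (¬supportedˡ , ¬supportedʳ)
    where
    module P = CompressedPartition (compressed-partition nd se part ev distinct primeRef subRef)

    ¬supportedʳ : ¬ Supported h (leaves r)
    ¬supportedʳ supp with i , j , i≢j ← ¬Form1⇒two-elements se part primeRef ¬form₁ =
      i≢j (P.Supported-right⇒single-element supp i j)

    ¬supportedˡ : ¬ Supported h (leaves l)
    ¬supportedˡ supp =
      [ ¬form₁ , ¬form₂ ]′
        (distinct-constant-subs⇒Form1⊎Form2 se part primeRef const-sub distinct-consts)
      where
      const-sub-value : ∀ i → ∃[ c ] proj₂ (lookup els i) ≡ const c × (∀ a → sub se i a ≡ c)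
      const-sub-value i = Ref-constant (P.Supported-left⇒constant-subs supp i) (subRef i)
      const-sub : ∀ i → ∃[ c ] proj₂ (lookup els i) ≡ const c
      const-sub i = Product.map₂ proj₁ (const-sub-value i)
      distinct-consts : ∀ {i j} → i ≢ j → proj₁ (const-sub i) ≢ proj₁ (const-sub j)
      distinct-consts {i} {j} i≢j c≡c′ = i≢j (P.sub-injective λ a →
        trans (proj₂ (proj₂ (const-sub-value i)) a)
              (trans c≡c′ (sym (proj₂ (proj₂ (const-sub-value j)) a))))

  mutual
    sem-Spans : ∀ {α k h d t} → Sem v α k h → Compressed v α k → Trimmed α →
      Node v k d t → Spans t h
    sem-Spans (sem-lit nd denotes) _ _ nd′ with refl , refl ← Node-functional nd nd′ refl =
      literal-Spans denotes
    sem-Spans (sem-dec nd se part ev) (distinct , cels) (¬form₁ , ¬form₂ , tels) nd′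
      with refl , refl ← Node-functional nd nd′ refl =
      decomposition-Spans nd se part ev distinct ¬form₁ ¬form₂
        (proj₁ ∘ element-Refs nd se cels tels) (proj₂ ∘ element-Refs nd se cels tels)

    element-Refs : ∀ {k dk l r els fs} → Node v k dk (node l r) → (se : SemEls v k els fs) →
      CompressedEls v k els → TrimmedEls els →
      ∀ i → Ref L k l r (prime se i) (proj₁ (lookup els i)) ×
            Ref R k l r (sub se i) (proj₂ (lookup els i))
    element-Refs nd ((belowᵖ , belowˢ , semᵖ , semˢ) ∷ _) (cᵖ , cˢ , _) (tᵖ , tˢ , _) zero =
      reference L nd belowᵖ semᵖ cᵖ tᵖ , reference R nd belowˢ semˢ cˢ tˢ
    element-Refs nd (_ ∷ se) (_ , _ , cels) (_ , _ , tels) (suc i) = element-Refs nd se cels tels i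

    reference : ∀ S {k dk l r p h} → Node v k dk (node l r) → Below S k p → SemV v k p h →
      CompressedV v k p → TrimmedV p → Ref S k l r h p
    reference S nd _ (semv-const q) _ _ = const-ref q
    reference S {k} {dk} nd below (semv-str {s = α} {d = e} sem) c t
      with j , dj , sp , n , e+k≡ ← Below-child S nd below =
      str-ref′ (+-cancelʳ-≡ k e _ (trans e+k≡ (+-comm k _))) n nodeᵥ (sem-Spans sem c t nodeᵥ)
      where
      nodeᵥ : Node v (e ℕ.+ k) (dk ℕ.+ suc dj) sp
      nodeᵥ = subst (λ i → Node v i (dk ℕ.+ suc dj) sp) (sym e+k≡) (Node-trans nd (Node-child S n))
      str-ref′ : ∀ {l r j} → e ≡ offset S l j → Node (child S l r) j dj sp →
        Node v (e ℕ.+ k) (dk ℕ.+ suc dj) sp → Spans sp _ → Ref S k l r _ ⟨ α , e ⟩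
      str-ref′ refl n nodeᵥ spanned = str-ref n nodeᵥ (canonical sem c t) spanned

  record DecompositionAt (k : ℕ) (h : BoolFun M) (els : List (VS × VS)) (l r : VTree M) : Set where
    field
      dk           : ℕ
      fs           : List (BoolFun M × BoolFun M)
      node-k       : Node v k dk (node l r)
      elements     : SemEls v k els fs
      is-partition : IsPartition (map proj₁ fs)
      denotes      : ∀ a → h a ≡ ⋁ fs a
      distinct     : DistinctSubs v k els
      compressed   : CompressedEls v k els
      trimmed      : TrimmedEls els

    primeRef : ∀ i → Ref L k l r (prime elements i) (proj₁ (lookup els i))
    primeRef = proj₁ ∘ element-Refs node-k elements compressed trimmed

    subRef : ∀ i → Ref R k l r (sub elements i) (proj₂ (lookup els i))
    subRef = proj₂ ∘ element-Refs node-k elements compressed trimmed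

    partition : CompressedPartition (leaves l) (leaves r) (length els) h
    partition = compressed-partition node-k elements is-partition denotes distinct primeRef subRef

    child-disjoint-leaves : ∀ S → DisjointLeaves (child S l r)
    child-disjoint-leaves S = child-DisjointLeaves S (Node-DisjointLeaves node-k disjoint-leaves)

  decomposition : ∀ {k h els d l r} → Canonical (dec els) k h → Node v k d (node l r) →
    DecompositionAt k h els l r
  decomposition (canonical (sem-dec nd se part ev) (distinct , cels) (_ , _ , tels)) ndk
    with refl , refl ← Node-functional nd ndk refl = record
    { node-k = nd ; elements = se ; is-partition = part ; denotes = ev
    ; distinct = distinct ; compressed = cels ; trimmed = tels }

  -- Canonicity

  -- The fuel n bounds the size of the subtree at k: the recursion into matched elements is not
  -- structural.
  mutual
    canonical-≈S : ∀ n (π : Fin M ↔ Fin M) {α k f β ℓ g dk dℓ tk tℓ} → size tk ≤ n →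
      Canonical α k f → Canonical β ℓ g → Node v k dk tk → Node v ℓ dℓ tℓ →
      (I : Iso tk tℓ) → Matches (Inverse.to π) I → f ≈[ Inverse.to π ] g → α ≈S β
    canonical-≈S zero _ {tk = tk} bound _ _ _ _ _ _ _ = ⊥-elim (<⇒≱ (Node-index<size {t = tk} here) bound)
    canonical-≈S _ π _ (canonical (sem-lit _ denotes) _ _) (canonical (sem-lit _ denotes′) _ _) _ _ _ _ f≈g
      with refl ← trans (sym (literal-sign denotes)) (trans (f≈g _) (literal-sign denotes′)) = lit≈
    canonical-≈S _ _ _ (canonical (sem-lit nd _) _ _) _ ndk _ (node _ _) _ _
      with () ← proj₂ (Node-functional nd ndk refl)
    canonical-≈S _ _ _ (canonical (sem-dec nd _ _ _) _ _) _ ndk _ (leaf _ _) _ _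
      with () ← proj₂ (Node-functional nd ndk refl)
    canonical-≈S _ _ _ _ (canonical (sem-lit nd _) _ _) _ ndℓ (node _ _) _ _
      with () ← proj₂ (Node-functional nd ndℓ refl)
    canonical-≈S _ _ _ _ (canonical (sem-dec nd _ _ _) _ _) _ ndℓ (leaf _ _) _ _
      with () ← proj₂ (Node-functional nd ndℓ refl)
    canonical-≈S (suc n) π bound A@(canonical (sem-dec _ _ _ _) _ _) B@(canonical (sem-dec _ _ _ _) _ _)
      ndk ndℓ (node I₁ I₂) matches f≈g =
      dec≈ (All-lookup⁺ (decomposition-matched n π DA DB bound I₁ I₂ matches f≈g))
           (All-lookup⁺ (decomposition-matched n (↔-sym π) DB DA
                           (subst (_≤ suc n) (Iso-size (node I₁ I₂)) bound)
                           (Iso-sym I₁) (Iso-sym I₂) (Matches-sym π (node I₁ I₂) matches) g≈f))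
      where
      DA = decomposition A ndk
      DB = decomposition B ndℓ
      g≈f = ≈[]-sym π
        (Supported⇒Extensional (CompressedPartition.supported (DecompositionAt.partition DB))) f≈g

    decomposition-matched : ∀ n (π : Fin M ↔ Fin M) {k ℓ f g els els′ l r l′ r′} →
      DecompositionAt k f els l r → DecompositionAt ℓ g els′ l′ r′ → size (node l r) ≤ suc n →
      (I₁ : Iso l l′) (I₂ : Iso r r′) → Matches (Inverse.to π) (node I₁ I₂) →
      f ≈[ Inverse.to π ] g → ∀ i → Any (lookup els i ≈E_) els′
    decomposition-matched n π A B bound I₁ I₂ matches f≈g i =
      let i′ , primes , subs = matching-element π A.partition B.partition
                                 (Matches-leaves I₁ matchesˡ) (Matches-leaves I₂ matchesʳ) f≈g i
      in lose (∈-lookup i′)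
        (el≈ (related-Refs n π L (A.primeRef i) (B.primeRef i′) (A.child-disjoint-leaves L) I₁ matchesˡ
                (Iso-size I₁) (≤-pred (≤-trans (child-size< L) bound)) primes)
             (related-Refs n π R (A.subRef i) (B.subRef i′) (A.child-disjoint-leaves R) I₂ matchesʳ
                (Iso-size I₁) (≤-pred (≤-trans (child-size< R) bound)) subs))
      where
      module A = DecompositionAt A
      module B = DecompositionAt B
      matchesˡ = Matches-left I₁ I₂ matches
      matchesʳ = Matches-right I₁ I₂ matches

    related-Refs : ∀ n (π : Fin M ↔ Fin M) S {k ℓ l r l′ r′ h h′ p p′} →
      Ref S k l r h p → Ref S ℓ l′ r′ h′ p′ → DisjointLeaves (child S l r) →
      (K : Iso (child S l r) (child S l′ r′)) → Matches (Inverse.to π) K → size l ≡ size l′ →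
      size (child S l r) ≤ n → h ≈[ Inverse.to π ] h′ → p ≈V p′
    related-Refs n π S (const-ref q) (const-ref q′) _ _ _ _ _ h≈h′
      with refl ← trans (sym (q _)) (trans (h≈h′ (λ _ → true)) (q′ _)) = const≈
    related-Refs n π S (const-ref q) (str-ref _ _ _ spanned′) _ _ _ _ _ h≈h′ =
      ⊥-elim (Constant⇒¬Nontrivial
        (λ a c → trans (h′≈h a) (trans (q _) (sym (trans (h′≈h c) (q _))))) (Spans.nontrivial spanned′))
      where h′≈h = ≈[]-sym π (Supported⇒Extensional (Spans.supported spanned′)) h≈h′
    related-Refs n π S (str-ref _ _ _ spanned) (const-ref q′) _ _ _ _ _ h≈h′ =
      ⊥-elim (Constant⇒¬Nontrivial
        (λ a c → trans (h≈h′ a) (trans (q′ _) (sym (trans (h≈h′ c) (q′ _))))) (Spans.nontrivial spanned))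
    related-Refs n π S (str-ref nc nᵥ canon spanned) (str-ref {j = j′} nc′ nᵥ′ canon′ spanned′)
      dl K matches size≡ bound h≈h′
      with sq , nq , J , J⊆K ← Iso-Node K nc′
      with j≡j′ ← Spans-unique dl nc nq spanned
                    (Spans-transport π J (Matches-⊆ K matches J J⊆K) h≈h′ spanned′)
      with refl , refl ← Node-functional nc nq j≡j′
      rewrite j≡j′ | offset-cong S j′ size≡ =
      str≈ (canonical-≈S n π (≤-trans (Node-size≤ nc) bound) canon canon′ nᵥ nᵥ′
              J (Matches-⊆ K matches J J⊆K) h≈h′)

  Sem-Node : ∀ {α k h} → Sem v α k h → ∃[ d ] ∃[ t ] Node v k d t
  Sem-Node (sem-lit nd _)     = _ , _ , nd
  Sem-Node (sem-dec nd _ _ _) = _ , _ , nd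

  EssDepNode⇒ID : ∀ {α k f u} → Canonical α k f → EssDepNode v f u → k ≡ u
  EssDepNode⇒ID (canonical sem c t) (_ , _ , tu , nu , deps⊆tu , deepest)
    with dk , tk , nk ← Sem-Node sem =
    split-node-deepest disjoint-leaves nontrivial nk split supported nu
      (DependsOn⊆⇒Supported (Supported⇒Extensional supported) deps⊆tu)
      (deepest _ dk tk nk λ _ → Supported⇒DependsOn⊆ supported)
    where open Spans (sem-Spans sem c t nk)

i+[j-i]≡j : ∀ i j → i + (j - i) ≡ j
i+[j-i]≡j = solve-∀

theorem2 : ∀ {M : ℕ} (v : VTree M) → IsVtree v →
    (u w du dw : ℕ) (tu tw : VTree M) → Node v u du tu → Node v w dw tw →
    (iso : Iso tu tw) →
    (π : Fin M ⤖ Fin M) →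
    (∀ x y → (x , y) ∈ corr iso → Bijection.to π y ≡ x) →
    (f g : BoolFun M) → EssDepNode v f u → EssDepNode v g w →
    (∀ a → f a ≡ g (a ∘ Bijection.to π)) →
    (α : Struct) (k : ℕ) (β : Struct) (ℓ : ℕ) →
    Sem v α k f → Compressed v α k → Trimmed α →
    Sem v β ℓ g → Compressed v β ℓ → Trimmed β →
    α ≈S β × (+ ℓ ≡ + k + (+ w - + u))
theorem2 v vtree u w _ _ tu _ nu nw iso π matches _ _ dep-f dep-g f≈g α k β ℓ semα cα tα semβ cβ tβ
  with dl ← IsVtree⇒DisjointLeaves v vtree
  with refl ← EssDepNode⇒ID v dl (canonical semα cα tα) dep-f
     | refl ← EssDepNode⇒ID v dl (canonical semβ cβ tβ) dep-g =
  canonical-≈S v dl (size tu) (⤖⇒↔ π) ≤-refl (canonical semα cα tα) (canonical semβ cβ tβ)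
    nu nw iso matches f≈g ,
  sym (i+[j-i]≡j (+ u) (+ w))
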